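{- Let $\mapsto_\gamma$ be a substitutive root relation on $\Lambda$ and $\mathsf e\in\{\mathsf l,\mathsf w\}$. Then $\to_{\neg\mathsf e\gamma}\cdot\to_{\mathsf e\beta_v}\subseteq\to_{\mathsf e\beta_v}\cdot\to_\gamma^*$.
   Context: Terms $\Lambda$: $t::=x\mid c\mid\lambda x.t\mid tt$ modulo $\alpha$-equivalence ($c$ constants), with capture-avoiding substitution $t\{x:=q\}$. Values $v::=x\mid c\mid\lambda x.t$. Contexts $C::=\langle\cdot\rangle\mid tC\mid Ct\mid\lambda x.C$; contextual closure of $\mapsto_\rho$: $C\langle r\rangle\to_\rho C\langle r'\rangle$ for $r\mapsto_\rho r'$. $\beta_v$ rule: $(\lambda x.t)v\mapsto_{\beta_v}t\{x:=v\}$, $v$ a value. Left contexts $L::=\langle\cdot\rangle\mid Lt\mid vL$; weak contexts $W::=\langle\cdot\rangle\mid Wt\mid tW$. $\to_{\mathsf e\rho}$: closure of $\mapsto_\rho$ under left ($\mathsf e=\mathsf l$) or weak ($\mathsf e=\mathsf w$) contexts; $\to_{\neg\mathsf e\rho}$: closure under contexts that are not such. $\mapsto$ is substitutive if $r\mapsto r'$ implies $r\{x:=q\}\mapsto r'\{x:=q\}$ for all $x,q$. $\to^*$ reflexive-transitive closure; $R\cdot S$ composition. -}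

module Defs where

open import Data.Nat using (ℕ; zero; suc; _≟_)
open import Data.Unit using (⊤)
open import Data.Product using (Σ; _×_; _,_; ∃-syntax)
open import Relation.Nullary using (¬_; yes; no)
open import Relation.Binary.PropositionalEquality using (_≡_)
open import Relation.Binary.Construct.Closure.ReflexiveTransitive using (Star)

-- Lambda terms with constants drawn from an arbitrary set C, in de Bruijn
-- notation (this is terms modulo alpha-equivalence; free variables are ℕ).
data Term (C : Set) : Set where
  var : ℕ → Term C
  con : C → Term C
  lam : Term C → Term C
  app : Term C → Term C → Term C

module _ {C : Set} where

  ext : (ℕ → ℕ) → ℕ → ℕ
  ext ρ zero = zero
  ext ρ (suc n) = suc (ρ n)

  rename : (ℕ → ℕ) → Term C → Term C
  rename ρ (var n) = var (ρ n)
  rename ρ (con c) = con c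
  rename ρ (lam t) = lam (rename (ext ρ) t)
  rename ρ (app t u) = app (rename ρ t) (rename ρ u)

  exts : (ℕ → Term C) → ℕ → Term C
  exts σ zero = var zero
  exts σ (suc n) = rename suc (σ n)

  subst : (ℕ → Term C) → Term C → Term C
  subst σ (var n) = σ n
  subst σ (con c) = con c
  subst σ (lam t) = lam (subst (exts σ) t)
  subst σ (app t u) = app (subst σ t) (subst σ u)

  single : ℕ → Term C → ℕ → Term C
  single x q n with n ≟ x
  ... | yes _ = q
  ... | no  _ = var n

  _⟨_≔_⟩ : Term C → ℕ → Term C → Term C
  t ⟨ x ≔ q ⟩ = subst (single x q) t

  β-sub : Term C → ℕ → Term C
  β-sub v zero = v
  β-sub v (suc n) = var n

  _[_]₀ : Term C → Term C → Term C
  t [ v ]₀ = subst (β-sub v) t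

  data IsValue : Term C → Set where
    v-var : ∀ n → IsValue (var n)
    v-con : ∀ c → IsValue (con c)
    v-lam : ∀ t → IsValue (lam t)

  Rel : Set₁
  Rel = Term C → Term C → Set

  Substitutive : Rel → Set
  Substitutive R = ∀ {r r'} → R r r' → ∀ x q → R (r ⟨ x ≔ q ⟩) (r' ⟨ x ≔ q ⟩)

  data βv : Rel where
    βv-rule : ∀ t v → IsValue v → βv (app (lam t) v) (t [ v ]₀)

  data Ctx : Set where
    hole : Ctx
    ctxR : Term C → Ctx → Ctx
    ctxL : Ctx → Term C → Ctx
    ctxλ : Ctx → Ctx

  plug : Ctx → Term C → Term C
  plug hole r = r
  plug (ctxR t K) r = app t (plug K r)
  plug (ctxL K t) r = app (plug K r) t
  plug (ctxλ K) r = lam (plug K r)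

  data IsLeftCtx : Ctx → Set where
    l-hole : IsLeftCtx hole
    l-L    : ∀ {K} t → IsLeftCtx K → IsLeftCtx (ctxL K t)
    l-R    : ∀ {K} v → IsValue v → IsLeftCtx K → IsLeftCtx (ctxR v K)

  data IsWeakCtx : Ctx → Set where
    w-hole : IsWeakCtx hole
    w-L    : ∀ {K} t → IsWeakCtx K → IsWeakCtx (ctxL K t)
    w-R    : ∀ {K} t → IsWeakCtx K → IsWeakCtx (ctxR t K)

  ClosureBy : (Ctx → Set) → Rel → Rel
  ClosureBy P R t u =
    Σ Ctx λ K → P K × (∃[ r ] ∃[ r' ] (R r r' × t ≡ plug K r × u ≡ plug K r'))

  Step : Rel → Rel
  Step = ClosureBy (λ _ → ⊤)

  _·_ : Rel → Rel → Rel
  (R · S) t u = ∃[ m ] (R t m × S m u)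

data Strategy : Set where
  l w : Strategy

module _ {C : Set} where
  IsECtx : Strategy → Ctx {C} → Set
  IsECtx l = IsLeftCtx
  IsECtx w = IsWeakCtx

  EStep : Strategy → Rel {C} → Rel {C}
  EStep e = ClosureBy (IsECtx e)

  NotEStep : Strategy → Rel {C} → Rel {C}
  NotEStep e = ClosureBy (λ K → ¬ IsECtx e K)

  StepStar : Rel {C} → Rel {C}
  StepStar R = Star (Step R)

module Submission where

-- Write the given steps as N⟨r⟩ →¬eγ N⟨r'⟩ = E⟨(λs)v⟩ →eβv E⟨s[v]⟩ with N not
-- an e-context and E an e-context.  Comparing N and E position by position, the
-- γ-redex either lies in a subterm disjoint from the βv-redex (the two steps are
-- swapped), or inside the βv-redex: in the body s (it survives contraction as
-- one γ-step on s[v]), or inside the value v, necessarily an abstraction (it is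
-- copied by the substitution and becomes several γ-steps on s[v]).
--
-- Both redex-internal cases need →γ to be closed under the *parallel*
-- substitutions of de Bruijn terms (β-contraction and shifting under binders),
-- whereas substitutivity only speaks about single substitutions t{x:=q}.

open import Defs
open import Data.Nat using (ℕ; zero; suc; _≟_; _+_; _≤_; _<_; _⊔_; pred)
open import Data.Nat.Properties
  using (≤-refl; <⇒≤; ≤-trans; <-≤-trans; <⇒≢; n<1+n; m<n⇒m<1+n; m<1+n⇒m<n∨m≡n; m≤m+n; m≤n+m;
         m≤m⊔n; m≤n⊔m; m<n⇒m<n⊔o; m<n⇒m<o⊔n; pred-mono-≤; +-cancelˡ-≡)
open import Data.Unit using (tt)
open import Data.Empty using (⊥-elim)
open import Data.Sum using (inj₁; inj₂)
open import Data.Product using (_×_; _,_)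
open import Function using (id)
open import Relation.Nullary using (¬_; yes; no)
open import Relation.Binary.PropositionalEquality
  using (_≡_; _≢_; refl; sym; trans; cong; cong₂; module ≡-Reasoning)
  renaming (subst₂ to transport₂)
open import Relation.Binary.Construct.Closure.ReflexiveTransitive
  using (ε; _◅◅_; gmap; return)

module _ {C : Set} where

  -- (1) Fusion laws, each stated for an arbitrary pointwise description of
  -- the composite, so that binder cases follow by the same law one level down.

  rename-rename : ∀ {ρ ρ' π : ℕ → ℕ} → (∀ n → ρ (ρ' n) ≡ π n) →
                  (t : Term C) → rename ρ (rename ρ' t) ≡ rename π t
  rename-rename h (var n)   = cong var (h n)
  rename-rename h (con c)   = refl
  rename-rename {ρ} {ρ'} {π} h (lam t) = cong lam (rename-rename ext-h t)
    where
    ext-h : ∀ n → ext {C} ρ (ext {C} ρ' n) ≡ ext {C} π n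
    ext-h zero    = refl
    ext-h (suc n) = cong suc (h n)
  rename-rename h (app t u) = cong₂ app (rename-rename h t) (rename-rename h u)

  rename-subst : ∀ {ρ : ℕ → ℕ} {σ θ : ℕ → Term C} → (∀ n → rename ρ (σ n) ≡ θ n) →
                 (t : Term C) → rename ρ (subst σ t) ≡ subst θ t
  rename-subst h (var n)   = h n
  rename-subst h (con c)   = refl
  rename-subst {ρ} {σ} {θ} h (lam t) = cong lam (rename-subst exts-h t)
    where
    open ≡-Reasoning
    exts-h : ∀ n → rename (ext {C} ρ) (exts σ n) ≡ exts θ n
    exts-h zero    = refl
    exts-h (suc n) = begin
      rename (ext {C} ρ) (rename suc (σ n)) ≡⟨ rename-rename (λ _ → refl) (σ n) ⟩
      rename (λ m → suc (ρ m)) (σ n)        ≡⟨ sym (rename-rename (λ _ → refl) (σ n)) ⟩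
      rename suc (rename ρ (σ n))           ≡⟨ cong (rename suc) (h n) ⟩
      rename suc (θ n)                      ∎
  rename-subst h (app t u) = cong₂ app (rename-subst h t) (rename-subst h u)

  subst-rename : ∀ {σ θ : ℕ → Term C} {ρ : ℕ → ℕ} → (∀ n → σ (ρ n) ≡ θ n) →
                 (t : Term C) → subst σ (rename ρ t) ≡ subst θ t
  subst-rename h (var n)   = h n
  subst-rename h (con c)   = refl
  subst-rename {σ} {θ} {ρ} h (lam t) = cong lam (subst-rename exts-h t)
    where
    exts-h : ∀ n → exts σ (ext {C} ρ n) ≡ exts θ n
    exts-h zero    = refl
    exts-h (suc n) = cong (rename suc) (h n)
  subst-rename h (app t u) = cong₂ app (subst-rename h t) (subst-rename h u)

  subst-subst : ∀ {σ τ θ : ℕ → Term C} → (∀ n → subst σ (τ n) ≡ θ n) →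
                (t : Term C) → subst σ (subst τ t) ≡ subst θ t
  subst-subst h (var n)   = h n
  subst-subst h (con c)   = refl
  subst-subst {σ} {τ} {θ} h (lam t) = cong lam (subst-subst exts-h t)
    where
    open ≡-Reasoning
    exts-h : ∀ n → subst (exts σ) (exts τ n) ≡ exts θ n
    exts-h zero    = refl
    exts-h (suc n) = begin
      subst (exts σ) (rename suc (τ n))     ≡⟨ subst-rename (λ _ → refl) (τ n) ⟩
      subst (λ m → rename suc (σ m)) (τ n) ≡⟨ sym (rename-subst (λ _ → refl) (τ n)) ⟩
      rename suc (subst σ (τ n))           ≡⟨ cong (rename suc) (h n) ⟩
      rename suc (θ n)                     ∎
  subst-subst h (app t u) = cong₂ app (subst-subst h t) (subst-subst h u)

  subst-var : ∀ {σ : ℕ → Term C} → (∀ n → σ n ≡ var n) → (t : Term C) → subst σ t ≡ t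
  subst-var h (var n)   = h n
  subst-var h (con c)   = refl
  subst-var {σ} h (lam t) = cong lam (subst-var exts-h t)
    where
    exts-h : ∀ n → exts σ n ≡ var n
    exts-h zero    = refl
    exts-h (suc n) = cong (rename suc) (h n)
  subst-var h (app t u) = cong₂ app (subst-var h t) (subst-var h u)

  rename-as-subst : ∀ {ρ : ℕ → ℕ} {σ : ℕ → Term C} → (∀ n → var (ρ n) ≡ σ n) →
                    (t : Term C) → rename ρ t ≡ subst σ t
  rename-as-subst h (var n)   = h n
  rename-as-subst h (con c)   = refl
  rename-as-subst {ρ} {σ} h (lam t) = cong lam (rename-as-subst ext-h t)
    where
    ext-h : ∀ n → var (ext {C} ρ n) ≡ exts σ n
    ext-h zero    = refl
    ext-h (suc n) = cong (rename suc) (h n)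
  rename-as-subst h (app t u) = cong₂ app (rename-as-subst h t) (rename-as-subst h u)

  fvBound : Term C → ℕ
  fvBound (var n)   = suc n
  fvBound (con c)   = zero
  fvBound (lam t)   = pred (fvBound t)
  fvBound (app t u) = fvBound t ⊔ fvBound u

  subst-local : ∀ {σ τ : ℕ → Term C} (t : Term C) →
                (∀ n → n < fvBound t → σ n ≡ τ n) → subst σ t ≡ subst τ t
  subst-local (var n)   h = h n ≤-refl
  subst-local (con c)   h = refl
  subst-local {σ} {τ} (lam t) h = cong lam (subst-local t exts-h)
    where
    exts-h : ∀ n → n < fvBound t → exts σ n ≡ exts τ n
    exts-h zero    _  = refl
    exts-h (suc n) lt = cong (rename suc) (h n (pred-mono-≤ lt))
  subst-local (app t u) h =
    cong₂ app (subst-local t (λ n lt → h n (m<n⇒m<n⊔o (fvBound u) lt)))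
              (subst-local u (λ n lt → h n (m<n⇒m<o⊔n (fvBound t) lt)))

  single-self : ∀ x (q : Term C) → single x q x ≡ q
  single-self x q with x ≟ x
  ... | yes _ = refl
  ... | no x≢x = ⊥-elim (x≢x refl)

  single-other : ∀ x (q : Term C) n → n ≢ x → single x q n ≡ var n
  single-other x q n n≢x with n ≟ x
  ... | yes n≡x = ⊥-elim (n≢x n≡x)
  ... | no _    = refl

  subst-single-fresh : ∀ x (q t : Term C) → fvBound t ≤ x → subst (single x q) t ≡ t
  subst-single-fresh x q t t≤x = trans
    (subst-local t (λ n n<t → single-other x q n (λ n≡x → <⇒≢ (<-≤-trans n<t t≤x) n≡x)))
    (subst-var (λ _ → refl) t)

  StableUnder : Rel {C} → (ℕ → Term C) → Set
  StableUnder γ σ = ∀ {r r'} → γ r r' → γ (subst σ r) (subst σ r')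

  ParallelSubstitutive : Rel {C} → Set
  ParallelSubstitutive γ = ∀ σ → StableUnder γ σ

  stable-var : ∀ {γ} → StableUnder γ var
  stable-var {γ} {r} {r'} g =
    transport₂ γ (sym (subst-var (λ _ → refl) r)) (sym (subst-var (λ _ → refl) r')) g

  stable-comp : ∀ {γ} σ τ → StableUnder γ σ → StableUnder γ τ →
                StableUnder γ (λ n → subst σ (τ n))
  stable-comp {γ} _ _ stσ stτ {r} {r'} g =
    transport₂ γ (subst-subst (λ _ → refl) r) (subst-subst (λ _ → refl) r') (stσ (stτ g))

  iterSingle : (ℕ → ℕ) → (ℕ → Term C) → ℕ → ℕ → Term C
  iterSingle x q zero    = var
  iterSingle x q (suc k) n = subst (single (x k) (q k)) (iterSingle x q k n)

  stable-iterSingle : ∀ {γ} → Substitutive γ → ∀ x q k → StableUnder γ (iterSingle x q k)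
  stable-iterSingle {γ} sγ x q zero    = stable-var {γ}
  stable-iterSingle {γ} sγ x q (suc k) =
    stable-comp {γ} (single (x k) (q k)) (iterSingle x q k) (λ g → sγ g (x k) (q k))
                (stable-iterSingle {γ} sγ x q k)

  iterSingle-miss : ∀ x q k n → (∀ j → j < k → x j ≢ n) → iterSingle x q k n ≡ var n
  iterSingle-miss x q zero    n miss = refl
  iterSingle-miss x q (suc k) n miss
    rewrite iterSingle-miss x q k n (λ j j<k → miss j (m<n⇒m<1+n j<k)) =
    single-other (x k) (q k) n (λ n≡xk → miss k (n<1+n k) (sym n≡xk))

  iterSingle-hit : ∀ x q k →
    (∀ i j → i < j → j < k → x i ≢ x j) →
    (∀ i j → i < j → j < k → subst (single (x j) (q j)) (q i) ≡ q i) →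
    ∀ i → i < k → iterSingle x q k (x i) ≡ q i
  iterSingle-hit x q (suc k) distinct undisturbed i i<1+k with m<1+n⇒m<n∨m≡n i<1+k
  ... | inj₁ i<k
    rewrite iterSingle-hit x q k (λ i j i<j j<k → distinct i j i<j (m<n⇒m<1+n j<k))
                                 (λ i j i<j j<k → undisturbed i j i<j (m<n⇒m<1+n j<k)) i i<k =
    undisturbed i k i<k (n<1+n k)
  ... | inj₂ refl
    rewrite iterSingle-miss x q i (x i) (λ j j<i → distinct j i j<i (n<1+n i)) =
    single-self (x i) (q i)

  maxBelow : (ℕ → ℕ) → ℕ → ℕ
  maxBelow f zero    = zero
  maxBelow f (suc k) = f k ⊔ maxBelow f k

  maxBelow-≥ : ∀ f k j → j < k → f j ≤ maxBelow f k
  maxBelow-≥ f (suc k) j j<1+k with m<1+n⇒m<n∨m≡n j<1+k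
  ... | inj₁ j<k  = ≤-trans (maxBelow-≥ f k j j<k) (m≤n⊔m (f k) (maxBelow f k))
  ... | inj₂ refl = m≤m⊔n (f j) (maxBelow f k)

  freshAbove : (ℕ → Term C) → ℕ → ℕ
  freshAbove σ B = B + maxBelow (λ j → fvBound (σ j)) B

  freshAbove-bounds : ∀ σ B j → j < B → fvBound (σ j) ≤ freshAbove σ B
  freshAbove-bounds σ B j j<B = ≤-trans (maxBelow-≥ (λ k → fvBound (σ k)) B j j<B) (m≤n+m _ B)

  -- Realising σ on the variables below B by single substitutions: first move
  -- each n < B to the fresh variable D + n, then replace D + n by σ n.
  moveAway : (ℕ → Term C) → ℕ → ℕ → Term C
  moveAway σ B = iterSingle id (λ k → var (freshAbove σ B + k)) B

  fillIn : (ℕ → Term C) → ℕ → ℕ → Term C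
  fillIn σ B = iterSingle (freshAbove σ B +_) σ B

  realise : (ℕ → Term C) → ℕ → ℕ → Term C
  realise σ B n = subst (fillIn σ B) (moveAway σ B n)

  moveAway-hit : ∀ σ B n → n < B → moveAway σ B n ≡ var (freshAbove σ B + n)
  moveAway-hit σ B = iterSingle-hit id _ B (λ i j i<j _ → <⇒≢ i<j) undisturbed
    where
    D = freshAbove σ B
    undisturbed : ∀ i j → i < j → j < B → single j (var (D + j)) (D + i) ≡ var (D + i)
    undisturbed i j _ j<B = single-other j _ (D + i)
      (λ D+i≡j → <⇒≢ (<-≤-trans j<B (≤-trans (m≤m+n B _) (m≤m+n D i))) (sym D+i≡j))

  fillIn-hit : ∀ σ B n → n < B → fillIn σ B (freshAbove σ B + n) ≡ σ n
  fillIn-hit σ B = iterSingle-hit (D +_) σ B distinct undisturbed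
    where
    D = freshAbove σ B
    distinct : ∀ i j → i < j → j < B → D + i ≢ D + j
    distinct i j i<j _ D+i≡D+j = <⇒≢ i<j (+-cancelˡ-≡ D i j D+i≡D+j)
    undisturbed : ∀ i j → i < j → j < B → subst (single (D + j) (σ j)) (σ i) ≡ σ i
    undisturbed i j i<j j<B = subst-single-fresh (D + j) (σ j) (σ i)
      (≤-trans (freshAbove-bounds σ B i (<-≤-trans i<j (<⇒≤ j<B))) (m≤m+n D j))

  realise-agrees : ∀ σ B n → n < B → realise σ B n ≡ σ n
  realise-agrees σ B n n<B = trans (cong (subst (fillIn σ B)) (moveAway-hit σ B n n<B))
                                   (fillIn-hit σ B n n<B)

  -- Substitutivity for single substitutions yields it for all substitutions:
  -- on the finitely many free variables of r and r', σ is a composite of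
  -- single substitutions.
  substitutive⇒parallel : ∀ {γ} → Substitutive γ → ParallelSubstitutive γ
  substitutive⇒parallel {γ} sγ σ {r} {r'} g =
    transport₂ γ (realise-subst r (m≤m⊔n _ _)) (realise-subst r' (m≤n⊔m _ _)) (stable-realise g)
    where
    B = fvBound r ⊔ fvBound r'
    stable-realise : StableUnder γ (realise σ B)
    stable-realise = stable-comp {γ} (fillIn σ B) (moveAway σ B)
                                 (stable-iterSingle {γ} sγ _ σ B) (stable-iterSingle {γ} sγ id _ B)
    realise-subst : ∀ t → fvBound t ≤ B → subst (realise σ B) t ≡ subst σ t
    realise-subst t t≤B = subst-local t (λ n n<t → realise-agrees σ B n (<-≤-trans n<t t≤B))

  step-in : ∀ {R : Rel {C}} K {r r'} → R r r' → Step R (plug K r) (plug K r')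
  step-in K g = K , tt , _ , _ , g , refl , refl

  step-appL : ∀ {R : Rel {C}} {a b} c → Step R a b → Step R (app a c) (app b c)
  step-appL c (K , _ , _ , _ , g , refl , refl) = step-in (ctxL K c) g

  step-appR : ∀ {R : Rel {C}} {a b} c → Step R a b → Step R (app c a) (app c b)
  step-appR c (K , _ , _ , _ , g , refl , refl) = step-in (ctxR c K) g

  step-lam : ∀ {R : Rel {C}} {a b} → Step R a b → Step R (lam a) (lam b)
  step-lam (K , _ , _ , _ , g , refl , refl) = step-in (ctxλ K) g

  -- A step survives substitution; under a binder the substitution is shifted,
  -- which is why stability under all substitutions is required.
  step-subst : ∀ {R : Rel {C}} → ParallelSubstitutive R →
               ∀ σ {a b} → Step R a b → Step R (subst σ a) (subst σ b)
  step-subst {R} stable σ (K , _ , _ , _ , g , refl , refl) = in-context K σ g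
    where
    in-context : ∀ K σ {r r'} → R r r' → Step R (subst σ (plug K r)) (subst σ (plug K r'))
    in-context hole       σ g = step-in hole (stable σ g)
    in-context (ctxR t K) σ g = step-appR (subst σ t) (in-context K σ g)
    in-context (ctxL K t) σ g = step-appL (subst σ t) (in-context K σ g)
    in-context (ctxλ K)   σ g = step-lam (in-context K (exts σ) g)

  step-rename : ∀ {R : Rel {C}} → ParallelSubstitutive R →
                ∀ ρ {a b} → Step R a b → Step R (rename ρ a) (rename ρ b)
  step-rename {R} stable ρ {a} {b} st =
    transport₂ (Step R) (sym (rename-as-subst (λ _ → refl) a)) (sym (rename-as-subst (λ _ → refl) b))
               (step-subst stable (λ n → var (ρ n)) st)

  star-subst-pointwise : ∀ {R : Rel {C}} → ParallelSubstitutive R →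
    ∀ {σ τ} → (∀ n → StepStar R (σ n) (τ n)) → ∀ s → StepStar R (subst σ s) (subst τ s)
  star-subst-pointwise stable h (var n) = h n
  star-subst-pointwise stable h (con c) = ε
  star-subst-pointwise {R} stable {σ} {τ} h (lam s) =
    gmap lam step-lam (star-subst-pointwise stable exts-h s)
    where
    exts-h : ∀ n → StepStar R (exts σ n) (exts τ n)
    exts-h zero    = ε
    exts-h (suc n) = gmap (rename suc) (step-rename stable suc) (h n)
  star-subst-pointwise stable {σ} {τ} h (app s u) =
    gmap (λ x → app x (subst σ u)) (step-appL _) (star-subst-pointwise stable h s) ◅◅
    gmap (app (subst τ s)) (step-appR _) (star-subst-pointwise stable h u)

  e-hole : ∀ e → IsECtx e (hole {C})
  e-hole l = l-hole
  e-hole w = w-hole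

  e-ctxL : ∀ e {K : Ctx {C}} t → IsECtx e K → IsECtx e (ctxL K t)
  e-ctxL l t K∈e = l-L t K∈e
  e-ctxL w t K∈e = w-L t K∈e

  e-ctxL⁻¹ : ∀ e {K : Ctx {C}} {t} → IsECtx e (ctxL K t) → IsECtx e K
  e-ctxL⁻¹ l (l-L _ K∈e) = K∈e
  e-ctxL⁻¹ w (w-L _ K∈e) = K∈e

  -- IsECtx e (ctxR c hole) says that evaluation may pass over the function c.
  e-ctxR : ∀ e {c} {K : Ctx {C}} → IsECtx e (ctxR c hole) → IsECtx e K → IsECtx e (ctxR c K)
  e-ctxR l (l-R _ c-val _) K∈e = l-R _ c-val K∈e
  e-ctxR w (w-R _ _)       K∈e = w-R _ K∈e

  e-ctxR⁻¹ : ∀ e {c} {K : Ctx {C}} → IsECtx e (ctxR c K) → IsECtx e K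
  e-ctxR⁻¹ l (l-R _ _ K∈e) = K∈e
  e-ctxR⁻¹ w (w-R _ K∈e)   = K∈e

  e-ctxR-head : ∀ e {c} {K : Ctx {C}} → IsECtx e (ctxR c K) → IsECtx e (ctxR c hole)
  e-ctxR-head l (l-R _ c-val _) = l-R _ c-val l-hole
  e-ctxR-head w (w-R _ _)       = w-R _ w-hole

  e-ctxλ : ∀ e {K : Ctx {C}} → ¬ IsECtx e (ctxλ K)
  e-ctxλ l ()
  e-ctxλ w ()

  e-lam-head : ∀ e (s : Term C) → IsECtx e (ctxR (lam s) hole)
  e-lam-head l s = l-R (lam s) (v-lam s) l-hole
  e-lam-head w s = w-R (lam s) w-hole

  -- A function that evaluation may pass over stays so after a step in a
  -- non-evaluation position: in left mode such a function is a value, and a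
  -- value with a hole that is not at the root is an abstraction.
  e-head-reduct : ∀ e (N : Ctx {C}) {r r'} → ¬ IsECtx e N →
                  IsECtx e (ctxR (plug N r') hole) → IsECtx e (ctxR (plug N r) hole)
  e-head-reduct l hole        N∉e _ = ⊥-elim (N∉e l-hole)
  e-head-reduct l (ctxλ N)    _   _ = l-R _ (v-lam _) l-hole
  e-head-reduct l (ctxL _ _)  _   (l-R _ () _)
  e-head-reduct l (ctxR _ _)  _   (l-R _ () _)
  e-head-reduct w N           _   _ = w-R _ w-hole

  estep-in : ∀ e {R : Rel {C}} {K} {r r'} → IsECtx e K → R r r' → EStep e R (plug K r) (plug K r')
  estep-in e K∈e g = _ , K∈e , _ , _ , g , refl , refl

  estep-appL : ∀ e {R : Rel {C}} {a b} c → EStep e R a b → EStep e R (app a c) (app b c)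
  estep-appL e c (K , K∈e , _ , _ , g , refl , refl) = estep-in e (e-ctxL e c K∈e) g

  estep-appR : ∀ e {R : Rel {C}} {a b c} → IsECtx e (ctxR c hole) →
               EStep e R a b → EStep e R (app c a) (app c b)
  estep-appR e c-head (K , K∈e , _ , _ , g , refl , refl) = estep-in e (e-ctxR e c-head K∈e) g

  app-injective : ∀ {a b c d : Term C} → app a b ≡ app c d → a ≡ c × b ≡ d
  app-injective refl = refl , refl

module Commutation {C : Set} (γ : Rel {C}) (γ-stable : ParallelSubstitutive γ) (e : Strategy) where

  Postponed : Rel {C}
  Postponed = EStep e βv · StepStar γ

  postponed-appL : ∀ {a b} c → Postponed a b → Postponed (app a c) (app b c)
  postponed-appL c (m , ev , γs) = app m c , estep-appL e c ev , gmap (λ x → app x c) (step-appL c) γs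

  postponed-appR : ∀ {a b c} → IsECtx e (ctxR c hole) → Postponed a b → Postponed (app c a) (app c b)
  postponed-appR {c = c} c-head (m , ev , γs) =
    app c m , estep-appR e c-head ev , gmap (app c) (step-appR c) γs

  redex-in-body : ∀ {s s' v} → Step γ s s' → IsValue v → Postponed (app (lam s) v) (s' [ v ]₀)
  redex-in-body {s} {v = v} st v-val =
    s [ v ]₀ , estep-in e (e-hole e) (βv-rule s v v-val) , return (step-subst γ-stable (β-sub v) st)

  redex-in-arg : ∀ {s v v'} → Step γ v v' → IsValue v → Postponed (app (lam s) v) (s [ v' ]₀)
  redex-in-arg {s} {v} {v'} st v-val =
    s [ v ]₀ , estep-in e (e-hole e) (βv-rule s v v-val) , star-subst-pointwise γ-stable copies s
    where
    copies : ∀ n → StepStar γ (β-sub v n) (β-sub v' n)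
    copies zero    = return st
    copies (suc n) = ε

  disjoint-left : ∀ {a a' b b'} → EStep e βv a a' → Step γ b b' → Postponed (app a b) (app a' b')
  disjoint-left {b = b} ev st = app _ b , estep-appL e b ev , return (step-appR _ st)

  disjoint-right : ∀ {a a' b b'} → IsECtx e (ctxR b hole) →
                   EStep e βv a a' → Step γ b b' → Postponed (app b a) (app b' a')
  disjoint-right {b = b} b-head ev st = app b _ , estep-appR e b-head ev , return (step-appL _ st)

  commute-root : ∀ N {r r' s v} → γ r r' → ¬ IsECtx e N →
                 plug N r' ≡ app (lam s) v → IsValue v → Postponed (plug N r) (s [ v ]₀)
  commute-root hole               g N∉e eq   v-val = ⊥-elim (N∉e (e-hole e))
  commute-root (ctxλ N)           g N∉e ()   v-val
  commute-root (ctxL hole c)      g N∉e eq   v-val = ⊥-elim (N∉e (e-ctxL e c (e-hole e)))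
  commute-root (ctxL (ctxλ N) c)  g N∉e refl v-val = redex-in-body (step-in N g) v-val
  commute-root (ctxL (ctxL _ _) c) g N∉e () v-val
  commute-root (ctxL (ctxR _ _) c) g N∉e () v-val
  commute-root (ctxR c hole)      g N∉e refl v-val = ⊥-elim (N∉e (e-lam-head e _))
  commute-root (ctxR c (ctxλ N))  g N∉e refl v-val = redex-in-arg (step-in (ctxλ N) g) (v-lam _)
  commute-root (ctxR c (ctxL _ _)) g N∉e refl ()
  commute-root (ctxR c (ctxR _ _)) g N∉e refl ()

  commute : ∀ N E {r r' s v} → γ r r' → ¬ IsECtx e N → IsECtx e E →
            plug N r' ≡ plug E (app (lam s) v) → IsValue v →
            Postponed (plug N r) (plug E (s [ v ]₀))
  commute N hole g N∉e E∈e eq v-val = commute-root N g N∉e eq v-val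
  commute N (ctxλ E) g N∉e E∈e eq v-val = ⊥-elim (e-ctxλ e E∈e)
  commute hole (ctxL _ _) g N∉e E∈e eq v-val = ⊥-elim (N∉e (e-hole e))
  commute hole (ctxR _ _) g N∉e E∈e eq v-val = ⊥-elim (N∉e (e-hole e))
  commute (ctxλ N) (ctxL _ _) g N∉e E∈e () v-val
  commute (ctxλ N) (ctxR _ _) g N∉e E∈e () v-val
  commute (ctxL N c') (ctxL E c) g N∉e E∈e eq v-val with app-injective eq
  ... | N≡E , refl =
    postponed-appL c (commute N E g (λ N∈e → N∉e (e-ctxL e c N∈e)) (e-ctxL⁻¹ e E∈e) N≡E v-val)
  commute (ctxR c' N) (ctxR c E) g N∉e E∈e eq v-val with app-injective eq
  ... | refl , N≡E =
    postponed-appR c-head (commute N E g (λ N∈e → N∉e (e-ctxR e c-head N∈e)) (e-ctxR⁻¹ e E∈e) N≡E v-val)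
    where
    c-head = e-ctxR-head e E∈e
  commute (ctxR c' N) (ctxL E c) g N∉e E∈e refl v-val =
    disjoint-left (estep-in e (e-ctxL⁻¹ e E∈e) (βv-rule _ _ v-val)) (step-in N g)
  commute (ctxL N c') (ctxR c E) g N∉e E∈e refl v-val =
    disjoint-right (e-head-reduct e N (λ N∈e → N∉e (e-ctxL e _ N∈e)) (e-ctxR-head e E∈e))
                   (estep-in e (e-ctxR⁻¹ e E∈e) (βv-rule _ _ v-val)) (step-in N g)

lemmaA4 : {C : Set} (γ : Rel {C}) → Substitutive γ → (e : Strategy) →
    ∀ t u → (NotEStep e γ · EStep e βv) t u →
    (EStep e βv · StepStar γ) t u
lemmaA4 γ γ-subst e _ _
  (_ , (N , N∉e , _ , _ , g , refl , refl) , (E , E∈e , _ , _ , βv-rule s v v-val , eq , refl)) =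
  Commutation.commute γ (substitutive⇒parallel {γ = γ} γ-subst) e N E g N∉e E∈e eq v-val
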